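{- Let $k,s$ be positive integers and let $\mathcal{F}^*\subseteq\binom{[n]}{k}$ be a $(k,s)$-homogeneous family with intersection pattern $\mathcal{J}$. If $r(\mathcal{J})=p$, then $|\mathcal{F}^*|\leq\binom{n}{p}$.
   Context: A family $\mathcal{F}\subseteq\binom{[n]}{k}$ is $k$-partite with $k$-partition $(X_1,\ldots,X_k)$ if $X_1,\ldots,X_k$ partition $[n]$ and $|F\cap X_i|=1$ for all $F\in\mathcal{F}$, $i\in[k]$. For $S\subseteq[n]$ its pattern is $\Pi(S)=\{i: S\cap X_i\neq\emptyset\}$, and $\Pi(\mathcal{L})=\{\Pi(S):S\in\mathcal{L}\}$. For $F\in\mathcal{F}$, $\mathcal{I}(F,\mathcal{F})=\{F\cap F': F'\in\mathcal{F},F'\neq F\}$. An $s$-star with kernel $A$ is a family of sets $F_1,\ldots,F_s$ with $F_i\cap F_j=A$ for all $i<j$. A family $\mathcal{F}^*\subseteq\binom{[n]}{k}$ is $(k,s)$-homogeneous with intersection pattern $\mathcal{J}$ if: $\mathcal{F}^*$ is $k$-partite with a $k$-partition $(X_1,\ldots,X_k)$; $\mathcal{J}$ is a family of proper subsets of $[k]$ with $\Pi(\mathcal{I}(F,\mathcal{F}^*))=\mathcal{J}$ for all $F\in\mathcal{F}^*$; $\mathcal{J}$ is closed under intersection; and for every $F\in\mathcal{F}^*$ and every $A\in\mathcal{I}(F,\mathcal{F}^*)$ there is an $s$-star in $\mathcal{F}^*$ containing $F$ with kernel $A$. The rank of a family $\mathcal{L}$ of subsets of $[k]$ is $r(\mathcal{L})=\min\{|D|: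 D\subseteq[k],\ \text{no } B\in\mathcal{L}\text{ satisfies } D\subseteq B\}$. -}

module Defs where

open import Data.Nat using (ℕ; _≤_)
open import Data.Fin using (Fin; _≟_)
open import Data.Fin.Subset using (Subset; _∈_; _∩_; _⊆_; ∣_∣; ⊤)
open import Data.Fin.Subset.Properties using (_∈?_)
open import Data.Fin.Properties using (any?)
open import Data.Vec using (tabulate)
open import Data.List using (List)
import Data.List.Membership.Propositional as L
open import Data.Product using (Σ; ∃; _×_)
open import Relation.Nullary using (¬_; does)
open import Relation.Nullary.Decidable using (_×-dec_)
open import Relation.Binary.PropositionalEquality using (_≡_; _≢_)

-- A k-partition (X_1,…,X_k) of [n] is given by a map part : Fin n → Fin k,
-- with X_i = part⁻¹(i).
Part : (n k : ℕ) → Set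
Part n k = Fin n → Fin k

X : ∀ {n k} → Part n k → Fin k → Subset n
X part i = tabulate (λ x → does (part x ≟ i))

Π : ∀ {n k} → Part n k → Subset n → Subset k
Π {n} part S = tabulate (λ i → does (any? (λ x → (x ∈? S) ×-dec (part x ≟ i))))

-- a family of k-subsets of [n]: a duplicate-free list (uniqueness imposed in the statement)
Family : ℕ → Set
Family n = List (Subset n)

KPartite : ∀ {n} k → Part n k → Family n → Set
KPartite k part 𝓕 =
  ∀ F → F L.∈ 𝓕 → (∣ F ∣ ≡ k) × (∀ i → ∣ F ∩ X part i ∣ ≡ 1)

InI : ∀ {n} → Subset n → Family n → Subset n → Set
InI F 𝓕 A = Σ _ λ F' → F' L.∈ 𝓕 × F' ≢ F × A ≡ F ∩ F'

StarIn : ∀ {n} (s : ℕ) → Family n → Subset n → Subset n → Set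
StarIn s 𝓕 F A = Σ (Fin s → Subset _) λ G →
  (∀ i → G i L.∈ 𝓕) × (∃ λ i → G i ≡ F) × (∀ i j → i ≢ j → G i ∩ G j ≡ A)

Homogeneous : ∀ {n} (k s : ℕ) → Family n → (Subset k → Set) → Set
Homogeneous {n} k s 𝓕 𝓙 = Σ (Part n k) λ part →
    KPartite k part 𝓕
  × (∀ B → 𝓙 B → B ≢ ⊤)
  × (∀ F → F L.∈ 𝓕 → ∀ B → 𝓙 B ⇔' (∃ λ A → InI F 𝓕 A × Π part A ≡ B))
  × (∀ A B → 𝓙 A → 𝓙 B → 𝓙 (A ∩ B))
  × (∀ F → F L.∈ 𝓕 → ∀ A → InI F 𝓕 A → StarIn s 𝓕 F A)
  where
  _⇔'_ : Set → Set → Set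
  P ⇔' Q = (P → Q) × (Q → P)

Uncovered : ∀ {k} → (Subset k → Set) → Subset k → Set
Uncovered 𝓛 D = ¬ (∃ λ B → 𝓛 B × D ⊆ B)

RankIs : ∀ {k} → (Subset k → Set) → ℕ → Set
RankIs 𝓛 p = (∃ λ D → Uncovered 𝓛 D × ∣ D ∣ ≡ p) × (∀ D → Uncovered 𝓛 D → p ≤ ∣ D ∣)

module Submission where

-- Let (X_1,…,X_k) be the k-partition of 𝓕* and choose
-- D ⊆ [k] with |D| = p = r(𝓙) that lies in no member of 𝓙.  Map every F ∈ 𝓕* to its
-- trace  F ∩ X_D  on the union X_D of the classes X_i, i ∈ D.
--   * Since F meets each class in exactly one point, its trace has exactly |D| = p elements.
--   * The trace map is injective on 𝓕*: if F ≠ F' have the same trace, then F ∩ F'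
--     meets every class X_i with i ∈ D, i.e. D ⊆ Π(F ∩ F'); but Π(F ∩ F') ∈ 𝓙 because
--     F ∩ F' ∈ 𝓘(F, 𝓕*), contradicting the choice of D.
-- Hence 𝓕* injects into the p-subsets of [n], and |𝓕*| ≤ C(n, p).

open import Defs
open import Algebra.Properties.CommutativeSemigroup using (interchange)
open import Data.Bool using (Bool; true; false)
open import Data.Empty using (⊥-elim)
open import Data.Fin using (Fin; zero; suc; _≟_)
open import Data.Fin.Properties using (any?)
open import Data.Fin.Subset using (Subset; _∩_; ∣_∣; _∈_; _⊆_; _-_; ⊥; Nonempty)
open import Data.Fin.Subset.Properties
  using (_∈?_; nonempty?; Empty-unique; ∣⊥∣≡0; x∈p∩q⁺; x∈p∩q⁻; x∈p⇒∣p-x∣<∣p∣)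
open import Data.List using (List; []; _∷_; length; map)
open import Data.List.Properties using (length-map)
import Data.List.Membership.Propositional as L
open import Data.List.Relation.Unary.All as All using (All; []; _∷_)
open import Data.List.Relation.Unary.All.Properties as All using ()
open import Data.List.Relation.Unary.Any using (here; there)
open import Data.List.Relation.Unary.AllPairs using ([]; _∷_)
open import Data.List.Relation.Unary.Unique.Propositional using (Unique)
open import Data.Nat using (ℕ; zero; suc; _+_; _≤_; z≤n; s≤s; _<_)
open import Data.Nat.Combinatorics using (_C_; nCk+nC[k+1]≡[n+1]C[k+1])
open import Data.Nat.Properties
  using (+-mono-≤; +-suc; suc-injective; n≮0; 0≢1+n; +-commutativeSemigroup; module ≤-Reasoning)
open import Data.Product using (_×_; _,_; proj₁; proj₂)
open import Data.Vec using (_∷_; []; tabulate; lookup)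
open import Data.Vec.Properties using (lookup∘tabulate; []=⇒lookup; lookup⇒[]=)
open import Function using (_∘_)
open import Relation.Binary.PropositionalEquality
open import Relation.Nullary using (yes; no; does; contradiction)
open import Relation.Nullary.Decidable using (dec-true; _×-dec_)

∣p∣≡0⇒p≡⊥ : ∀ {n} (S : Subset n) → ∣ S ∣ ≡ 0 → S ≡ ⊥
∣p∣≡0⇒p≡⊥ S ∣S∣≡0 with nonempty? S
... | yes (x , x∈S) = contradiction (subst (∣ S - x ∣ <_) ∣S∣≡0 (x∈p⇒∣p-x∣<∣p∣ {p = S} x∈S)) n≮0
... | no  S-empty   = Empty-unique S-empty

∣p∣≡suc⇒Nonempty : ∀ {n m} (S : Subset n) → ∣ S ∣ ≡ suc m → Nonempty S
∣p∣≡suc⇒Nonempty {n} S ∣S∣≡suc with nonempty? S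
... | yes S-nonempty = S-nonempty
... | no  S-empty    =
  ⊥-elim (0≢1+n (trans (sym (∣⊥∣≡0 n)) (trans (cong ∣_∣ (sym (Empty-unique S-empty))) ∣S∣≡suc)))

unique-constant-≤1 : ∀ {A : Set} {a : A} (xs : List A) → Unique xs → All (_≡ a) xs → length xs ≤ 1
unique-constant-≤1 []          _                 _                    = z≤n
unique-constant-≤1 (_ ∷ [])    _                 _                    = s≤s z≤n
unique-constant-≤1 (_ ∷ _ ∷ _) ((x≢y ∷ _) ∷ _) (x≡a ∷ y≡a ∷ _) = contradiction (trans x≡a (sym y≡a)) x≢y

splitOnZero : ∀ {n} → List (Subset (suc n)) → List (Subset n) × List (Subset n)
splitOnZero []                = [] , []
splitOnZero ((true  ∷ S) ∷ 𝓛) = S ∷ proj₁ (splitOnZero 𝓛) , proj₂ (splitOnZero 𝓛)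
splitOnZero ((false ∷ S) ∷ 𝓛) = proj₁ (splitOnZero 𝓛) , S ∷ proj₂ (splitOnZero 𝓛)

splitOnZero-length : ∀ {n} (𝓛 : List (Subset (suc n))) →
  length 𝓛 ≡ length (proj₁ (splitOnZero 𝓛)) + length (proj₂ (splitOnZero 𝓛))
splitOnZero-length []                = refl
splitOnZero-length ((true  ∷ _) ∷ 𝓛) = cong suc (splitOnZero-length 𝓛)
splitOnZero-length ((false ∷ _) ∷ 𝓛) = trans (cong suc (splitOnZero-length 𝓛)) (sym (+-suc _ _))

splitOnZero-All : ∀ {n} {P : Subset (suc n) → Set} (𝓛 : List (Subset (suc n))) → All P 𝓛 →
  All (P ∘ (true ∷_)) (proj₁ (splitOnZero 𝓛)) × All (P ∘ (false ∷_)) (proj₂ (splitOnZero 𝓛))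
splitOnZero-All []                []       = [] , []
splitOnZero-All ((true  ∷ _) ∷ 𝓛) (p ∷ ps) = p ∷ proj₁ (splitOnZero-All 𝓛 ps) , proj₂ (splitOnZero-All 𝓛 ps)
splitOnZero-All ((false ∷ _) ∷ 𝓛) (p ∷ ps) = proj₁ (splitOnZero-All 𝓛 ps) , p ∷ proj₂ (splitOnZero-All 𝓛 ps)

splitOnZero-Unique : ∀ {n} (𝓛 : List (Subset (suc n))) → Unique 𝓛 →
  Unique (proj₁ (splitOnZero 𝓛)) × Unique (proj₂ (splitOnZero 𝓛))
splitOnZero-Unique []                [] = [] , []
splitOnZero-Unique ((true ∷ _) ∷ 𝓛) (S∉ ∷ u) =
  All.map (λ ne → ne ∘ cong (true ∷_)) (proj₁ (splitOnZero-All 𝓛 S∉)) ∷ proj₁ (splitOnZero-Unique 𝓛 u)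
  , proj₂ (splitOnZero-Unique 𝓛 u)
splitOnZero-Unique ((false ∷ _) ∷ 𝓛) (S∉ ∷ u) =
  proj₁ (splitOnZero-Unique 𝓛 u)
  , All.map (λ ne → ne ∘ cong (false ∷_)) (proj₂ (splitOnZero-All 𝓛 S∉)) ∷ proj₂ (splitOnZero-Unique 𝓛 u)

p-subsets-bound : ∀ n p (𝓛 : List (Subset n)) → Unique 𝓛 → All (λ S → ∣ S ∣ ≡ p) 𝓛 → length 𝓛 ≤ n C p
p-subsets-bound n       zero    𝓛 u sizes =
  unique-constant-≤1 𝓛 u (All.map (∣p∣≡0⇒p≡⊥ _) sizes)
p-subsets-bound zero    (suc p) []       _ _        = z≤n
p-subsets-bound zero    (suc p) ([] ∷ _) _ (() ∷ _)
p-subsets-bound (suc n) (suc p) 𝓛 u sizes = begin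
  length 𝓛                          ≡⟨ splitOnZero-length 𝓛 ⟩
  length with0 + length without0
    ≤⟨ +-mono-≤ (p-subsets-bound n p with0 (proj₁ uniq) (All.map suc-injective (proj₁ sizes′)))
                (p-subsets-bound n (suc p) without0 (proj₂ uniq) (proj₂ sizes′)) ⟩
  n C p + n C suc p                  ≡⟨ nCk+nC[k+1]≡[n+1]C[k+1] n p ⟩
  suc n C suc p                      ∎
  where
  open ≤-Reasoning
  with0    = proj₁ (splitOnZero 𝓛)
  without0 = proj₂ (splitOnZero 𝓛)
  uniq     = splitOnZero-Unique 𝓛 u
  sizes′   = splitOnZero-All 𝓛 sizes

map-Unique : ∀ {A B : Set} (f : A → B) {xs : List A} →
  (∀ {x y} → x L.∈ xs → y L.∈ xs → x ≢ y → f x ≢ f y) → Unique xs → Unique (map f xs)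
map-Unique f {[]}     _        []       = []
map-Unique f {x ∷ xs} separate (x∉ ∷ u) =
  All.map⁺ (All.tabulate λ y∈ → separate (here refl) (there y∈) (All.lookup x∉ y∈))
  ∷ map-Unique f (λ x∈ y∈ → separate (there x∈) (there y∈)) u

χ : Bool → ℕ
χ true  = 1
χ false = 0

∣∷∣ : ∀ {n} b (S : Subset n) → ∣ b ∷ S ∣ ≡ χ b + ∣ S ∣
∣∷∣ true  S = refl
∣∷∣ false S = refl

sumOver : ∀ {k} → Subset k → (Fin k → ℕ) → ℕ
sumOver []          c = 0
sumOver (true  ∷ w) c = c zero + sumOver w (c ∘ suc)
sumOver (false ∷ w) c = sumOver w (c ∘ suc)

sumOver-cong : ∀ {k} (w : Subset k) {c d : Fin k → ℕ} → (∀ i → c i ≡ d i) → sumOver w c ≡ sumOver w d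
sumOver-cong []          c≗d = refl
sumOver-cong (true  ∷ w) c≗d = cong₂ _+_ (c≗d zero) (sumOver-cong w (c≗d ∘ suc))
sumOver-cong (false ∷ w) c≗d = sumOver-cong w (c≗d ∘ suc)

sumOver-0 : ∀ {k} (w : Subset k) → sumOver w (λ _ → 0) ≡ 0
sumOver-0 []          = refl
sumOver-0 (true  ∷ w) = sumOver-0 w
sumOver-0 (false ∷ w) = sumOver-0 w

sumOver-1 : ∀ {k} (w : Subset k) → sumOver w (λ _ → 1) ≡ ∣ w ∣
sumOver-1 []          = refl
sumOver-1 (true  ∷ w) = cong suc (sumOver-1 w)
sumOver-1 (false ∷ w) = sumOver-1 w

sumOver-+ : ∀ {k} (w : Subset k) (c d : Fin k → ℕ) →
  sumOver w (λ i → c i + d i) ≡ sumOver w c + sumOver w d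
sumOver-+ []          c d = refl
sumOver-+ (true  ∷ w) c d = trans (cong (c zero + d zero +_) (sumOver-+ w (c ∘ suc) (d ∘ suc)))
                                  (interchange +-commutativeSemigroup (c zero) (d zero) _ _)
sumOver-+ (false ∷ w) c d = sumOver-+ w (c ∘ suc) (d ∘ suc)

sumOver-δ : ∀ {k} (w : Subset k) (j : Fin k) → sumOver w (λ i → χ (does (j ≟ i))) ≡ χ (lookup w j)
sumOver-δ (true  ∷ w) zero    = cong suc (sumOver-0 w)
sumOver-δ (false ∷ w) zero    = sumOver-0 w
sumOver-δ (true  ∷ w) (suc j) = sumOver-δ w j
sumOver-δ (false ∷ w) (suc j) = sumOver-δ w j

⋃X : ∀ {n k} → Part n k → Subset k → Subset n
⋃X part w = tabulate (λ x → lookup w (part x))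

∈-tabulate⁻ : ∀ {n} {f : Fin n → Bool} {x} → x ∈ tabulate f → f x ≡ true
∈-tabulate⁻ {f = f} {x} x∈ = trans (sym (lookup∘tabulate f x)) ([]=⇒lookup x∈)

∈-tabulate⁺ : ∀ {n} {f : Fin n → Bool} {x} → f x ≡ true → x ∈ tabulate f
∈-tabulate⁺ {f = f} {x} fx = lookup⇒[]= x (tabulate f) (trans (lookup∘tabulate f x) fx)

∈X⁻ : ∀ {n k} {part : Part n k} {x i} → x ∈ X part i → part x ≡ i
∈X⁻ {part = part} {x} {i} x∈ with part x ≟ i | ∈-tabulate⁻ {f = λ y → does (part y ≟ i)} x∈
... | yes px≡i | _  = px≡i
... | no  _    | ()

∈⋃X⁺ : ∀ {n k} {part : Part n k} {w x} → part x ∈ w → x ∈ ⋃X part w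
∈⋃X⁺ px∈w = ∈-tabulate⁺ ([]=⇒lookup px∈w)

∈Π⁺ : ∀ {n k} {part : Part n k} {S x i} → x ∈ S → part x ≡ i → i ∈ Π part S
∈Π⁺ {part = part} {S} {x} {i} x∈S px≡i =
  ∈-tabulate⁺ (dec-true (any? λ y → (y ∈? S) ×-dec (part y ≟ i)) (x , x∈S , px≡i))

-- |S ∩ ⋃_{i∈w} X_i| = Σ_{i∈w} |S ∩ X_i|, since the classes are disjoint.
trace-size : ∀ {n k} (part : Part n k) (w : Subset k) (S : Subset n) →
  ∣ S ∩ ⋃X part w ∣ ≡ sumOver w (λ i → ∣ S ∩ X part i ∣)
trace-size part w []          = sym (sumOver-0 w)
trace-size part w (false ∷ S) = trace-size (part ∘ suc) w S
trace-size part w (true  ∷ S) = begin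
  ∣ lookup w (part zero) ∷ (S ∩ ⋃X part′ w) ∣
    ≡⟨ ∣∷∣ (lookup w (part zero)) (S ∩ ⋃X part′ w) ⟩
  χ (lookup w (part zero)) + ∣ S ∩ ⋃X part′ w ∣
    ≡⟨ cong₂ _+_ (sym (sumOver-δ w (part zero))) (trace-size part′ w S) ⟩
  sumOver w (λ i → χ (does (part zero ≟ i))) + sumOver w (λ i → ∣ S ∩ X part′ i ∣)
    ≡⟨ sym (sumOver-+ w (λ i → χ (does (part zero ≟ i))) (λ i → ∣ S ∩ X part′ i ∣)) ⟩
  sumOver w (λ i → χ (does (part zero ≟ i)) + ∣ S ∩ X part′ i ∣)
    ≡⟨ sumOver-cong w (λ i → sym (∣∷∣ (does (part zero ≟ i)) (S ∩ X part′ i))) ⟩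
  sumOver w (λ i → ∣ does (part zero ≟ i) ∷ (S ∩ X part′ i) ∣) ∎
  where
  open ≡-Reasoning
  part′ = part ∘ suc

transversal-trace-size : ∀ {n k} (part : Part n k) (w : Subset k) (F : Subset n) →
  (∀ i → ∣ F ∩ X part i ∣ ≡ 1) → ∣ F ∩ ⋃X part w ∣ ≡ ∣ w ∣
transversal-trace-size part w F transversal =
  trans (trace-size part w F) (trans (sumOver-cong w transversal) (sumOver-1 w))

pattern-covers : ∀ {n k} (part : Part n k) (D : Subset k) (F F' : Subset n) →
  (∀ {i} → i ∈ D → Nonempty (F ∩ X part i)) → F ∩ ⋃X part D ⊆ F' → D ⊆ Π part (F ∩ F')
pattern-covers part D F F' meets trace⊆F' {i} i∈D with meets i∈D
... | x , x∈F∩Xi with x∈p∩q⁻ F (X part i) x∈F∩Xi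
...   | x∈F , x∈Xi = ∈Π⁺ (x∈p∩q⁺ (x∈F , trace⊆F' (x∈p∩q⁺ (x∈F , ∈⋃X⁺ px∈D)))) px≡i
  where
  px≡i = ∈X⁻ {part = part} x∈Xi
  px∈D = subst (_∈ D) (sym px≡i) i∈D

trace-separates : ∀ {n k} (part : Part n k) (𝓕 : Family n) (𝓙 : Subset k → Set) (D : Subset k) →
  (∀ {F} → F L.∈ 𝓕 → ∀ i → ∣ F ∩ X part i ∣ ≡ 1) →
  (∀ {F F'} → F L.∈ 𝓕 → F' L.∈ 𝓕 → F' ≢ F → 𝓙 (Π part (F ∩ F'))) →
  Uncovered 𝓙 D →
  ∀ {F F'} → F L.∈ 𝓕 → F' L.∈ 𝓕 → F ≢ F' → F ∩ ⋃X part D ≢ F' ∩ ⋃X part D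
trace-separates part 𝓕 𝓙 D transversal pattern∈𝓙 uncovered {F} {F'} F∈ F'∈ F≢F' same-trace =
  uncovered (Π part (F ∩ F') , pattern∈𝓙 F∈ F'∈ (F≢F' ∘ sym) , pattern-covers part D F F' meets trace⊆F')
  where
  meets : ∀ {i} → i ∈ D → Nonempty (F ∩ X part i)
  meets {i} _ = ∣p∣≡suc⇒Nonempty (F ∩ X part i) (transversal F∈ i)
  trace⊆F' : F ∩ ⋃X part D ⊆ F'
  trace⊆F' x∈ = proj₁ (x∈p∩q⁻ F' _ (subst (_ ∈_) same-trace x∈))

proposition3p4 : ∀ (n k s p : ℕ) → 1 ≤ k → 1 ≤ s →
    (𝓕 : Family n) → Unique 𝓕 → (𝓙 : Subset k → Set) →
    Homogeneous k s 𝓕 𝓙 → RankIs 𝓙 p → length 𝓕 ≤ n C p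
proposition3p4 n k s p _ _ 𝓕 unique 𝓙 (part , partite , _ , patterns , _ , _) ((D , uncovered , ∣D∣≡p) , _) =
  begin
    length 𝓕             ≡⟨ sym (length-map trace 𝓕) ⟩
    length (map trace 𝓕) ≤⟨ p-subsets-bound n p (map trace 𝓕) traces-unique traces-sized ⟩
    n C p                ∎
  where
  open ≤-Reasoning
  trace : Subset n → Subset n
  trace F = F ∩ ⋃X part D
  transversal : ∀ {F} → F L.∈ 𝓕 → ∀ i → ∣ F ∩ X part i ∣ ≡ 1
  transversal F∈ = proj₂ (partite _ F∈)
  -- F ∩ F' ∈ 𝓘(F, 𝓕*), so its pattern belongs to 𝓙
  pattern∈𝓙 : ∀ {F F'} → F L.∈ 𝓕 → F' L.∈ 𝓕 → F' ≢ F → 𝓙 (Π part (F ∩ F'))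
  pattern∈𝓙 {F} {F'} F∈ F'∈ F'≢F = proj₂ (patterns F F∈ _) (F ∩ F' , (F' , F'∈ , F'≢F , refl) , refl)
  traces-unique : Unique (map trace 𝓕)
  traces-unique = map-Unique trace (trace-separates part 𝓕 𝓙 D transversal pattern∈𝓙 uncovered) unique
  traces-sized : All (λ S → ∣ S ∣ ≡ p) (map trace 𝓕)
  traces-sized = All.map⁺ (All.tabulate λ {F} F∈ →
    trans (transversal-trace-size part D F (transversal F∈)) ∣D∣≡p)
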